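{- Let $m\ge1$, $p\ge 0$, $r\in\{0,1\}$ and $n=2m+2p+r$. Let $\tilde\rho$ be the partition with $2m$ parts equal to $n$ followed by $(n-2,n-2,n-4,n-4,\ldots,2m,2m)$ if $r=0$, and by $(n-2,n-2,\ldots,2m+1,2m+1,2m)$ if $r=1$. Let $G$ be the weighted directed graph whose vertices are the boxes $(i,j)$ of the Young diagram of $\tilde\rho$ (row $i$ from the top, column $j$ from the left), with a directed edge from each box to the box immediately above and to the box immediately to the right (when these exist); vertical edges have weight $1$ and horizontal edges in row $i$ have weight $(-1)^{i-1}$. For $1\le t\le 2m$ let $T_t=(t,n)$, and call a vertex $x$ a zero point of $T_t$ if the sum over all directed paths $P$ from $x$ to $T_t$ of the product of the edge weights of $P$ equals $0$. If $(i-2,j)$ and $(i,j+2)$ are vertices of $G$ which are both zero points of some $T_t$, then $(i,j)$ is also a zero point of $T_t$.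
   Context: Empty sums are $0$. -}

module Defs where

open import Data.Nat using (ℕ; zero; suc; _+_; _*_; _∸_; _≤ᵇ_; _≡ᵇ_; _/_)
open import Data.Integer using (ℤ; -1ℤ; 1ℤ; 0ℤ) renaming (_*_ to _*ℤ_; _+_ to _+ℤ_; _^_ to _^ℤ_)
open import Data.Bool using (Bool; true; false; _∧_; if_then_else_; T)
open import Data.List using (List; []; _∷_; map; _++_)
open import Data.Maybe using (Maybe; just; nothing)
open import Data.Product using (_×_; _,_)
open import Relation.Binary.PropositionalEquality using (_≡_)

nOf : ℕ → ℕ → ℕ → ℕ
nOf m p r = 2 * m + 2 * p + r

-- Length of row i (rows numbered from 1) of the partition ρ̃:
--   rows 1 .. 2m      : n
--   row 2m + k, 1 ≤ k ≤ 2p : n - 2⌈k/2⌉   (i.e. n-2,n-2,n-4,n-4,…)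
--   row 2m + 2p + 1   : 2m  if r = 1 (for r = 0 there is no such row)
--   all other rows    : 0
rowLen : ℕ → ℕ → ℕ → ℕ → ℕ
rowLen m p r i =
  if i ≤ᵇ 2 * m then nOf m p r
  else (if i ≤ᵇ 2 * m + 2 * p then nOf m p r ∸ 2 * (((i ∸ 2 * m) + 1) / 2)
  else (if i ≤ᵇ nOf m p r then 2 * m else 0))

inDiag : ℕ → ℕ → ℕ → ℕ → ℕ → Bool
inDiag m p r i j = (1 ≤ᵇ i) ∧ (1 ≤ᵇ j) ∧ (j ≤ᵇ rowLen m p r i)

IsVertex : ℕ → ℕ → ℕ → ℕ → ℕ → Set
IsVertex m p r i j = T (inDiag m p r i j)

data Step : Set where
  up right : Step

words : ℕ → List (List Step)
words zero = [] ∷ []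
words (suc k) = map (up ∷_) (words k) ++ map (right ∷_) (words k)

hWeight : ℕ → ℤ
hWeight i = -1ℤ ^ℤ (i ∸ 1)

walk : ℕ → ℕ → ℕ → ℕ → ℕ → List Step → Maybe (ℤ × ℕ × ℕ)
walk m p r i j [] = just (1ℤ , i , j)
walk m p r i j (up ∷ w) with inDiag m p r (i ∸ 1) j
... | false = nothing
... | true = walk m p r (i ∸ 1) j w
walk m p r i j (right ∷ w) with inDiag m p r i (suc j)
... | false = nothing
... | true with walk m p r i (suc j) w
...   | nothing = nothing
...   | just (c , e) = just (hWeight i *ℤ c , e)

pathWeight : ℕ → ℕ → ℕ → ℕ → ℕ → ℕ → ℕ → List Step → ℤ
pathWeight m p r i j k l w with walk m p r i j w
... | nothing = 0ℤ
... | just (c , (a , b)) = if (a ≡ᵇ k) ∧ (b ≡ᵇ l) then c else 0ℤ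

sumℤ : List ℤ → ℤ
sumℤ [] = 0ℤ
sumℤ (x ∷ xs) = x +ℤ sumℤ xs

-- Every such path has exactly (i - k) up-steps and (l - j) right-steps, so it is
-- enumerated among the words of length (i ∸ k) + (l ∸ j); if no path exists the sum is 0.
pathSum : ℕ → ℕ → ℕ → ℕ → ℕ → ℕ → ℕ → ℤ
pathSum m p r i j k l = sumℤ (map (pathWeight m p r i j k l) (words ((i ∸ k) + (l ∸ j))))

ZeroPoint : ℕ → ℕ → ℕ → ℕ → ℕ → ℕ → Set
ZeroPoint m p r t i j = IsVertex m p r i j × (pathSum m p r i j t (nOf m p r) ≡ 0ℤ)

-- Writing F(a, b) for the path sum from (a, b) to the target, splitting off the first step gives
-- F(a, b) = F(a - 1, b) + w_a F(a, b + 1), where w_a = (-1)^(a-1) is the horizontal weight of row a.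
-- Expanding F(i, j) twice, the two paths through (i - 1, j + 1) carry the opposite weights w_{i-1}
-- and w_i and cancel, leaving F(i, j) = F(i - 2, j) + F(i, j + 2).  The neighbours used are boxes
-- because the row lengths of ρ̃ weakly decrease and never exceed n.
module Submission where

open import Defs
open import Data.Nat using (ℕ; zero; suc; _≤_; _<_; _*_; _∸_; _+_; _≤ᵇ_; _≡ᵇ_; _/_; z≤n; s≤s; _≤?_)
open import Data.Nat.Properties
open import Data.Nat.DivMod using (/-monoˡ-≤; m<n*o⇒m/o<n)
open import Data.Bool using (true; false; if_then_else_; T; _∧_)
open import Data.Bool.Properties using (T-∧; T-≡)
open import Data.Unit using (tt)
open import Data.Empty using (⊥-elim)
open import Data.Product using (_×_; _,_)
open import Data.List using (List; []; _∷_; map; _++_)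
open import Data.List.Properties using (map-++; map-∘; map-cong)
open import Data.Maybe using (just; nothing)
open import Data.Integer using (ℤ; 0ℤ; 1ℤ; -1ℤ) renaming (_+_ to _+ℤ_; _*_ to _*ℤ_; _^_ to _^ℤ_)
import Data.Integer.Properties as ℤ
import Data.Nat.Tactic.RingSolver as ℕ-Ring
import Data.Integer.Tactic.RingSolver as ℤ-Ring
open import Function using (const; _∘′_; Equivalence)
open import Relation.Nullary using (yes; no)
open import Relation.Nullary.Reflects using (ofʸ; ofⁿ)
open import Relation.Binary.PropositionalEquality

open Equivalence using (to; from)

Antitone : (ℕ → ℕ) → Set
Antitone f = ∀ i → f (suc i) ≤ f i

if≤_then_else_ : ℕ → (ℕ → ℕ) → (ℕ → ℕ) → ℕ → ℕ
(if≤ c then f else g) i = if i ≤ᵇ c then f i else g i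

if≤-antitone : ∀ c {f g} → Antitone f → Antitone g → (∀ x y → y ≤ c → g x ≤ f y) →
  Antitone (if≤ c then f else g)
if≤-antitone c f↓ g↓ g≤f i
  with suc i ≤ᵇ c | ≤ᵇ-reflects-≤ (suc i) c | i ≤ᵇ c | ≤ᵇ-reflects-≤ i c
... | true  | ofʸ _    | true  | ofʸ _   = f↓ i
... | true  | ofʸ 1+i≤c | false | ofⁿ i≰c = ⊥-elim (i≰c (<⇒≤ 1+i≤c))
... | false | ofⁿ _    | true  | ofʸ i≤c = g≤f (suc i) i i≤c
... | false | ofⁿ _    | false | ofⁿ _   = g↓ i

if≤-bounded : ∀ c {f g b} → (∀ i → f i ≤ b) → (∀ i → g i ≤ b) → ∀ i → (if≤ c then f else g) i ≤ b
if≤-bounded c f≤b g≤b i with i ≤ᵇ c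
... | true  = f≤b i
... | false = g≤b i

const-antitone : ∀ a → Antitone (const a)
const-antitone a _ = ≤-refl

module Shape (m p r : ℕ) where

  n : ℕ
  n = nOf m p r

  middleRow : ℕ → ℕ
  middleRow i = n ∸ 2 * (((i ∸ 2 * m) + 1) / 2)

  lastRow : ℕ → ℕ
  lastRow = if≤ n then const (2 * m) else const 0

  lowerRows : ℕ → ℕ
  lowerRows = if≤ 2 * m + 2 * p then middleRow else lastRow

  middleRow-antitone : Antitone middleRow
  middleRow-antitone i =
    ∸-monoʳ-≤ n (*-monoʳ-≤ 2 (/-monoˡ-≤ 2 (+-monoˡ-≤ 1 (∸-monoˡ-≤ (2 * m) (n≤1+n i)))))

  middleRow-index≤p : ∀ {i} → i ≤ 2 * m + 2 * p → ((i ∸ 2 * m) + 1) / 2 ≤ p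
  middleRow-index≤p {i} i≤ = ≤-pred (m<n*o⇒m/o<n (begin-strict
      (i ∸ 2 * m) + 1                    ≤⟨ +-monoˡ-≤ 1 (∸-monoˡ-≤ (2 * m) i≤) ⟩
      (2 * m + 2 * p ∸ 2 * m) + 1        ≡⟨ cong (_+ 1) (m+n∸m≡n (2 * m) (2 * p)) ⟩
      2 * p + 1                          <⟨ n<1+n (2 * p + 1) ⟩
      suc (2 * p + 1)                    ≡⟨ 2p+2≡[1+p]*2 p ⟩
      suc p * 2                          ∎))
    where
      open ≤-Reasoning
      2p+2≡[1+p]*2 : ∀ p → suc (2 * p + 1) ≡ suc p * 2
      2p+2≡[1+p]*2 = ℕ-Ring.solve-∀

  2m≤middleRow : ∀ {i} → i ≤ 2 * m + 2 * p → 2 * m ≤ middleRow i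
  2m≤middleRow i≤ = ≤-trans (m+n≤o⇒m≤o∸n (2 * m) (m≤m+n (2 * m + 2 * p) r))
                            (∸-monoʳ-≤ n (*-monoʳ-≤ 2 (middleRow-index≤p i≤)))

  middleRow≤n : ∀ i → middleRow i ≤ n
  middleRow≤n i = m∸n≤m n (2 * (((i ∸ 2 * m) + 1) / 2))

  2m≤n : 2 * m ≤ n
  2m≤n = ≤-trans (m≤m+n (2 * m) (2 * p)) (m≤m+n (2 * m + 2 * p) r)

  lastRow≤2m : ∀ i → lastRow i ≤ 2 * m
  lastRow≤2m = if≤-bounded n (λ _ → ≤-refl) (λ _ → z≤n)

  lowerRows≤n : ∀ i → lowerRows i ≤ n
  lowerRows≤n = if≤-bounded (2 * m + 2 * p) middleRow≤n (λ i → ≤-trans (lastRow≤2m i) 2m≤n)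

  lowerRows-antitone : Antitone lowerRows
  lowerRows-antitone = if≤-antitone (2 * m + 2 * p) middleRow-antitone
    (if≤-antitone n (const-antitone (2 * m)) (const-antitone 0) (λ _ _ _ → z≤n))
    (λ x y y≤ → ≤-trans (lastRow≤2m x) (2m≤middleRow y≤))

  -- rowLen m p r is definitionally if≤ 2 * m then const n else lowerRows.
  rowLen-antitone : Antitone (rowLen m p r)
  rowLen-antitone = if≤-antitone (2 * m) (const-antitone n) lowerRows-antitone (λ x _ _ → lowerRows≤n x)

  rowLen≤n : ∀ i → rowLen m p r i ≤ n
  rowLen≤n = if≤-bounded (2 * m) (λ _ → ≤-refl) lowerRows≤n

module Diagram (m p r : ℕ) where
  open Shape m p r using (n; rowLen-antitone; rowLen≤n)

  isVertex⁺ : ∀ {i j} → 1 ≤ i → 1 ≤ j → j ≤ rowLen m p r i → IsVertex m p r i j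
  isVertex⁺ 1≤i 1≤j j≤len = from T-∧ (≤⇒≤ᵇ 1≤i , from T-∧ (≤⇒≤ᵇ 1≤j , ≤⇒≤ᵇ j≤len))

  isVertex⁻ : ∀ {i j} → IsVertex m p r i j → 1 ≤ i × 1 ≤ j × j ≤ rowLen m p r i
  isVertex⁻ {i} {j} v with to T-∧ v
  ... | 1≤ᵇi , rest with to T-∧ rest
  ...   | 1≤ᵇj , j≤ᵇlen = ≤ᵇ⇒≤ 1 i 1≤ᵇi , ≤ᵇ⇒≤ 1 j 1≤ᵇj , ≤ᵇ⇒≤ j (rowLen m p r i) j≤ᵇlen

  isVertex-left : ∀ i j → 1 ≤ j → IsVertex m p r i (suc j) → IsVertex m p r i j
  isVertex-left i j 1≤j v with isVertex⁻ {i} {suc j} v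
  ... | 1≤i , _ , 1+j≤len = isVertex⁺ {i} {j} 1≤i 1≤j (<⇒≤ 1+j≤len)

  isVertex-up : ∀ i j → 1 ≤ i → IsVertex m p r (suc i) j → IsVertex m p r i j
  isVertex-up i j 1≤i v with isVertex⁻ {suc i} {j} v
  ... | _ , 1≤j , j≤len = isVertex⁺ {i} {j} 1≤i 1≤j (≤-trans j≤len (rowLen-antitone i))

  isVertex-column≥1 : ∀ i j → IsVertex m p r i j → 1 ≤ j
  isVertex-column≥1 i j v with isVertex⁻ {i} {j} v
  ... | _ , 1≤j , _ = 1≤j

  isVertex-column≤n : ∀ i j → IsVertex m p r i j → j ≤ n
  isVertex-column≤n i j v with isVertex⁻ {i} {j} v
  ... | _ , _ , j≤len = ≤-trans j≤len (rowLen≤n i)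

sumℤ-++ : ∀ xs ys → sumℤ (xs ++ ys) ≡ sumℤ xs +ℤ sumℤ ys
sumℤ-++ []       ys = sym (ℤ.+-identityˡ (sumℤ ys))
sumℤ-++ (x ∷ xs) ys = trans (cong (x +ℤ_) (sumℤ-++ xs ys)) (sym (ℤ.+-assoc x (sumℤ xs) (sumℤ ys)))

sumℤ-*ˡ : ∀ c xs → sumℤ (map (c *ℤ_) xs) ≡ c *ℤ sumℤ xs
sumℤ-*ˡ c []       = sym (ℤ.*-zeroʳ c)
sumℤ-*ˡ c (x ∷ xs) = trans (cong (c *ℤ x +ℤ_) (sumℤ-*ˡ c xs)) (sym (ℤ.*-distribˡ-+ c x (sumℤ xs)))

sumℤ-map-zero : ∀ {A : Set} {f : A → ℤ} → (∀ x → f x ≡ 0ℤ) → ∀ xs → sumℤ (map f xs) ≡ 0ℤ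
sumℤ-map-zero f≡0 []       = refl
sumℤ-map-zero f≡0 (x ∷ xs) = cong₂ _+ℤ_ (f≡0 x) (sumℤ-map-zero f≡0 xs)

hWeight-square : ∀ a → hWeight a *ℤ hWeight a ≡ 1ℤ
hWeight-square a = [-1]^n-square (a ∸ 1)
  where
    negate-square : ∀ x → (-1ℤ *ℤ x) *ℤ (-1ℤ *ℤ x) ≡ x *ℤ x
    negate-square = ℤ-Ring.solve-∀
    [-1]^n-square : ∀ n → -1ℤ ^ℤ n *ℤ -1ℤ ^ℤ n ≡ 1ℤ
    [-1]^n-square zero    = refl
    [-1]^n-square (suc n) = trans (negate-square (-1ℤ ^ℤ n)) ([-1]^n-square n)

alternating-cancel : ∀ h x y z → (y +ℤ h *ℤ x) +ℤ (-1ℤ *ℤ h) *ℤ (x +ℤ (-1ℤ *ℤ h) *ℤ z) ≡ y +ℤ (h *ℤ h) *ℤ z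
alternating-cancel = ℤ-Ring.solve-∀

module Paths (m p r k l : ℕ) where
  open Diagram m p r

  weight : ℕ → ℕ → List Step → ℤ
  weight a b = pathWeight m p r a b k l

  pathSumOfLength : ℕ → ℕ → ℕ → ℤ
  pathSumOfLength L a b = sumℤ (map (weight a b) (words L))

  weight-up : ∀ {a b} w → IsVertex m p r a b → weight (suc a) b (up ∷ w) ≡ weight a b w
  weight-up w v rewrite to T-≡ v = refl

  weight-right : ∀ {a b} w → IsVertex m p r a (suc b) →
    weight a b (right ∷ w) ≡ hWeight a *ℤ weight a (suc b) w
  weight-right {a} {b} w v rewrite to T-≡ v with walk m p r a (suc b) w
  ... | nothing = sym (ℤ.*-zeroʳ (hWeight a))
  ... | just (c , x , y) with (x ≡ᵇ k) ∧ (y ≡ᵇ l)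
  ...   | true  = refl
  ...   | false = sym (ℤ.*-zeroʳ (hWeight a))

  -- Paths only move up or right, so none starts strictly above the target row.
  weight-above-target : ∀ {a b} w → a < k → weight a b w ≡ 0ℤ
  weight-above-target {a} {b} [] a<k with a ≡ᵇ k in a≡ᵇk
  ... | false = refl
  ... | true  = ⊥-elim (<⇒≢ a<k (≡ᵇ⇒≡ a k (from T-≡ a≡ᵇk)))
  weight-above-target {a} {b} (up ∷ w) a<k with inDiag m p r (a ∸ 1) b
  ... | false = refl
  ... | true  = weight-above-target w (≤-<-trans (m∸n≤m a 1) a<k)
  weight-above-target {a} {b} (right ∷ w) a<k with inDiag m p r a (suc b) | weight-right {a} {b} w
  ... | false | _          = refl
  ... | true  | rightStep =
    trans (rightStep tt) (trans (cong (hWeight a *ℤ_) (weight-above-target w a<k)) (ℤ.*-zeroʳ (hWeight a)))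

  pathSumOfLength-above-target : ∀ L {a b} → a < k → pathSumOfLength L a b ≡ 0ℤ
  pathSumOfLength-above-target L a<k = sumℤ-map-zero (λ w → weight-above-target w a<k) (words L)

  pathSumOfLength-step : ∀ L {a b} → IsVertex m p r a b → IsVertex m p r (suc a) (suc b) →
    pathSumOfLength (suc L) (suc a) b ≡
      pathSumOfLength L a b +ℤ hWeight (suc a) *ℤ pathSumOfLength L (suc a) (suc b)
  pathSumOfLength-step L {a} {b} upV rightV = begin
      sumℤ (map f (ups ++ rights))
        ≡⟨ cong sumℤ (map-++ f ups rights) ⟩
      sumℤ (map f ups ++ map f rights)
        ≡⟨ sumℤ-++ (map f ups) (map f rights) ⟩
      sumℤ (map f ups) +ℤ sumℤ (map f rights)
        ≡⟨ cong₂ _+ℤ_ (cong sumℤ (trans (sym (map-∘ ws)) (map-cong (λ w → weight-up {a} {b} w upV) ws)))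
                      (cong sumℤ (trans (sym (map-∘ ws)) (map-cong (λ w → weight-right {suc a} {b} w rightV) ws))) ⟩
      pathSumOfLength L a b +ℤ sumℤ (map ((h *ℤ_) ∘′ weight (suc a) (suc b)) ws)
        ≡⟨ cong (λ s → pathSumOfLength L a b +ℤ sumℤ s) (map-∘ ws) ⟩
      pathSumOfLength L a b +ℤ sumℤ (map (h *ℤ_) (map (weight (suc a) (suc b)) ws))
        ≡⟨ cong (pathSumOfLength L a b +ℤ_) (sumℤ-*ˡ h (map (weight (suc a) (suc b)) ws)) ⟩
      pathSumOfLength L a b +ℤ h *ℤ pathSumOfLength L (suc a) (suc b) ∎
    where
      open ≡-Reasoning
      ws = words L
      ups = map (up ∷_) ws
      rights = map (right ∷_) ws
      f = weight (suc a) b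
      h = hWeight (suc a)

  pathSum-step : ∀ {a b} → b < l → IsVertex m p r a b → IsVertex m p r (suc a) (suc b) →
    pathSum m p r (suc a) b k l ≡
      pathSum m p r a b k l +ℤ hWeight (suc a) *ℤ pathSum m p r (suc a) (suc b) k l
  pathSum-step {a} {b} b<l upV rightV = begin
      pathSum m p r (suc a) b k l
        ≡⟨ cong (λ L′ → pathSumOfLength L′ (suc a) b) lengths ⟩
      pathSumOfLength (suc L) (suc a) b
        ≡⟨ pathSumOfLength-step L upV rightV ⟩
      pathSumOfLength L a b +ℤ hWeight (suc a) *ℤ pathSum m p r (suc a) (suc b) k l
        ≡⟨ cong (_+ℤ hWeight (suc a) *ℤ pathSum m p r (suc a) (suc b) k l) upper-length ⟩
      pathSum m p r a b k l +ℤ hWeight (suc a) *ℤ pathSum m p r (suc a) (suc b) k l ∎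
    where
      open ≡-Reasoning
      L : ℕ
      L = (suc a ∸ k) + (l ∸ suc b)
      l∸b : l ∸ b ≡ suc (l ∸ suc b)
      l∸b = +-∸-assoc 1 b<l
      lengths : (suc a ∸ k) + (l ∸ b) ≡ suc L
      lengths = trans (cong ((suc a ∸ k) +_) l∸b) (+-suc (suc a ∸ k) (l ∸ suc b))
      upper-length : pathSumOfLength L a b ≡ pathSum m p r a b k l
      upper-length with k ≤? a
      ... | yes k≤a = cong (λ L′ → pathSumOfLength L′ a b) (begin
              (suc a ∸ k) + (l ∸ suc b)  ≡⟨ cong (_+ (l ∸ suc b)) (+-∸-assoc 1 k≤a) ⟩
              suc (a ∸ k) + (l ∸ suc b)  ≡⟨ +-suc (a ∸ k) (l ∸ suc b) ⟨
              (a ∸ k) + suc (l ∸ suc b)  ≡⟨ cong ((a ∸ k) +_) l∸b ⟨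
              (a ∸ k) + (l ∸ b)          ∎)
      ... | no k≰a = trans (pathSumOfLength-above-target L (≰⇒> k≰a))
                           (sym (pathSumOfLength-above-target ((a ∸ k) + (l ∸ b)) (≰⇒> k≰a)))

  pathSum-twoStep : ∀ {a b} → suc b < l → IsVertex m p r a b → IsVertex m p r (suc (suc a)) (suc (suc b)) →
    pathSum m p r (suc (suc a)) b k l ≡ pathSum m p r a b k l +ℤ pathSum m p r (suc (suc a)) (suc (suc b)) k l
  pathSum-twoStep {a} {b} 1+b<l v corner = begin
      F (suc (suc a)) b
        ≡⟨ pathSum-step b<l besideCentre besideCorner ⟩
      F (suc a) b +ℤ -1ℤ *ℤ h *ℤ F (suc (suc a)) (suc b)
        ≡⟨ cong₂ (λ x y → x +ℤ -1ℤ *ℤ h *ℤ y) (pathSum-step b<l v centre) (pathSum-step 1+b<l centre corner) ⟩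
      (F a b +ℤ h *ℤ X) +ℤ (-1ℤ *ℤ h) *ℤ (X +ℤ (-1ℤ *ℤ h) *ℤ Z)
        ≡⟨ alternating-cancel h X (F a b) Z ⟩
      F a b +ℤ (h *ℤ h) *ℤ Z
        ≡⟨ cong (λ c → F a b +ℤ c *ℤ Z) (hWeight-square (suc a)) ⟩
      F a b +ℤ 1ℤ *ℤ Z
        ≡⟨ cong (F a b +ℤ_) (ℤ.*-identityˡ Z) ⟩
      F a b +ℤ Z ∎
    where
      open ≡-Reasoning
      F : ℕ → ℕ → ℤ
      F a′ b′ = pathSum m p r a′ b′ k l
      -- hWeight (2 + a) reduces to -1ℤ *ℤ h by the definition of _^_.
      h = hWeight (suc a)
      X = F (suc a) (suc b)
      Z = F (suc (suc a)) (suc (suc b))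
      b<l : b < l
      b<l = <-trans (n<1+n b) 1+b<l
      besideCorner : IsVertex m p r (suc (suc a)) (suc b)
      besideCorner = isVertex-left (suc (suc a)) (suc b) (s≤s z≤n) corner
      centre : IsVertex m p r (suc a) (suc b)
      centre = isVertex-up (suc a) (suc b) (s≤s z≤n) besideCorner
      besideCentre : IsVertex m p r (suc a) b
      besideCentre = isVertex-left (suc a) b (isVertex-column≥1 a b v) centre

proposition3p8 : (m p r : ℕ) → 1 ≤ m → r ≤ 1 →
    (t i j : ℕ) → 1 ≤ t → t ≤ 2 * m →
    IsVertex m p r (i ∸ 2) j → IsVertex m p r i (j + 2) →
    ZeroPoint m p r t (i ∸ 2) j → ZeroPoint m p r t i (j + 2) →
    ZeroPoint m p r t i j
proposition3p8 m p r _ _ t zero          j _ _ () _ _ _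
proposition3p8 m p r _ _ t (suc zero)    j _ _ () _ _ _
proposition3p8 m p r _ _ t (suc (suc i)) j _ _ top corner (_ , topZero) (_ , cornerZero)
  rewrite +-comm j 2 = box , (begin
      pathSum m p r (suc (suc i)) j t n
        ≡⟨ pathSum-twoStep (isVertex-column≤n (suc (suc i)) (suc (suc j)) corner) top corner ⟩
      pathSum m p r i j t n +ℤ pathSum m p r (suc (suc i)) (suc (suc j)) t n
        ≡⟨ cong₂ _+ℤ_ topZero cornerZero ⟩
      0ℤ ∎)
  where
    open ≡-Reasoning
    open Shape m p r using (n)
    open Diagram m p r
    open Paths m p r t n using (pathSum-twoStep)
    box : IsVertex m p r (suc (suc i)) j
    box = isVertex-left (suc (suc i)) j (isVertex-column≥1 i j top)
            (isVertex-left (suc (suc i)) (suc j) (s≤s z≤n) corner)
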